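{- Let $\Gamma$ be a finite link-regular simplicial graph with maximum clique size $d$, $\ell_0=|V\Gamma|$ and $\ell_k=|\mathrm{Lk}(\sigma)|$ for any $k$-clique $\sigma$ ($1\le k\le d$). Let $1\le m\le d$ and $0\le k\le m$. Then there is an integer $N_{m,k}$ such that for every ordered clique $(v_1,\dots,v_k,u)$ of $\Gamma$, the number of ordered $m$-cliques $(w_1,\dots,w_m)$ with $w_i=v_i$ for $1\le i\le k$ and $u\in\mathrm{Lk}(\{w_1,\dots,w_m\};\{w_1,\dots,w_k\})$ equals $N_{m,k}$ (in particular it does not depend on $v_1,\dots,v_k,u$). Moreover $N_{m,m}=1$; $N_{m,m-1}=\ell_{m-1}-\ell_m-1$; and for $k<m-1$, $N_{m,k}=\ell_{m-1}N_{m-1,k}-\ell_{k+1}N_{m,k+1}$.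
   Context: A clique is a vertex set spanning a complete subgraph; an ordered $m$-clique is a tuple of $m$ distinct vertices forming a clique. $\mathrm{Lk}(\sigma)=\{v\notin\sigma\mid\sigma\cup\{v\}\text{ clique}\}$, $\mathrm{Lk}(v)$ is the set of neighbours of $v$, and for a clique $\sigma$ and $\tau\subseteq\sigma$, $\mathrm{Lk}(\sigma;\tau)=\{v\in V\Gamma\setminus\sigma\mid\mathrm{Lk}(v)\cap\sigma=\tau\}$. $\Gamma$ is link-regular if any two cliques of the same size have links of the same size. -}

module Defs where

open import Data.Nat using (ℕ; _≤_; _<ᵇ_)
open import Data.Bool using (Bool; true; false; not; _∧_; _∨_)
import Data.Bool as B
open import Data.Fin using (Fin; toℕ; inject≤; _≟_)
open import Data.Fin.Subset using (Subset; _∈_; ∣_∣)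
open import Data.Vec using (Vec; lookup; tabulate; _∷ʳ_)
open import Data.Bool.ListAction using (all; any)
open import Data.List using () renaming (allFin to allFinL)
open import Data.Product using (Σ; _×_)
open import Relation.Binary.PropositionalEquality using (_≡_; _≢_)
open import Relation.Nullary.Decidable using (⌊_⌋)

record Graph : Set where
  field
    n         : ℕ
    adj       : Fin n → Fin n → Bool
    adj-sym   : ∀ u v → adj u v ≡ adj v u
    adj-irrefl : ∀ v → adj v v ≡ false

module _ (G : Graph) where
  open Graph G

  allF : (k : ℕ) → (Fin k → Bool) → Bool
  allF k p = all p (allFinL k)

  IsClique : Subset n → Set
  IsClique σ = ∀ u v → u ∈ σ → v ∈ σ → u ≢ v → adj u v ≡ true

  -- Lk(σ) = { v ∉ σ | σ ∪ {v} is a clique }   (for a clique σ)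
  Lk : Subset n → Subset n
  Lk σ = tabulate λ v → not (lookup σ v) ∧ allF n (λ x → not (lookup σ x) ∨ adj x v)

  LkRel : Subset n → Subset n → Subset n
  LkRel σ τ = tabulate λ v →
    not (lookup σ v) ∧ allF n (λ x → not (lookup σ x) ∨ ⌊ adj v x B.≟ lookup τ x ⌋)

  LinkRegular : Set
  LinkRegular = ∀ σ τ → IsClique σ → IsClique τ → ∣ σ ∣ ≡ ∣ τ ∣ → ∣ Lk σ ∣ ≡ ∣ Lk τ ∣

  MaxCliqueSize : ℕ → Set
  MaxCliqueSize d = Σ (Subset n) (λ σ → IsClique σ × ∣ σ ∣ ≡ d)
                  × (∀ σ → IsClique σ → ∣ σ ∣ ≤ d)

  -- ordered m-clique: pairwise distinct and pairwise adjacent entries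
  -- (adjacency is irreflexive, so adjacency of distinct positions gives distinctness)
  OrdClique : {m : ℕ} → Vec (Fin n) m → Bool
  OrdClique {m} w = allF m λ i → allF m λ j → ⌊ i ≟ j ⌋ ∨ adj (lookup w i) (lookup w j)

  toSet : {m : ℕ} → Vec (Fin n) m → Subset n
  toSet {m} w = tabulate λ x → any (λ i → ⌊ lookup w i ≟ x ⌋) (allFinL m)

  prefix : {k m : ℕ} → k ≤ m → Vec (Fin n) m → Vec (Fin n) k
  prefix k≤m w = tabulate λ i → lookup w (inject≤ i k≤m)

  Counted : {k m : ℕ} → k ≤ m → Vec (Fin n) k → Fin n → Vec (Fin n) m → Bool
  Counted {k} k≤m v u w =
    OrdClique w
    ∧ allF k (λ i → ⌊ lookup w (inject≤ i k≤m) ≟ lookup v i ⌋)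
    ∧ lookup (LkRel (toSet w) (toSet (prefix k≤m w))) u

module Submission where

-- Fix the ordered clique (v₁, …, v_k, u) and let E be the set of common neighbours of v₁, …, v_k
-- that are neither u nor adjacent to u. The counted m-cliques are exactly v ++ z with z an ordered
-- (m − k)-clique in E. Count the pairs (z , x) with z an ordered r-clique in E and x ∈ Lk(v ++ z):
-- by link-regularity there are ℓ_{k+r} choices of x for each z. On the other hand x either lies
-- in E, extending z to an (r + 1)-clique in E, or equals u (only if r = 0), or is adjacent to u,
-- in which case x ranges over the ℓ_{k+1} vertices of Lk({v₁, …, v_k, u}) and z over the ordered
-- r-cliques of the set E built from (v₁, …, v_k, x) instead. Hence, writing N_{k+r,k} for the
-- number of r-cliques in E, ℓ_{k+r} N_{k+r,k} = N_{k+r+1,k} + [r = 0] + ℓ_{k+1} N_{k+r+1,k+1},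
-- and induction on r shows that these numbers depend on k and m only.

module CliqueCounting where

  open import Defs
  open import Algebra.Bundles using (CommutativeMonoid)
  open import Data.Bool.Properties
    using (∧-assoc; ∧-comm; ∧-conicalˡ; ∧-conicalʳ; ∧-identityʳ; ∧-zeroʳ; ∨-assoc; ∨-zeroʳ;
           not-injective; not-¬; ¬-not; T-≡; ⇔→≡; ∧-commutativeMonoid)
  open import Algebra.Properties.CommutativeSemigroup (CommutativeMonoid.commutativeSemigroup ∧-commutativeMonoid)
    using () renaming (xy∙z≈xz∙y to ∧-swapʳ)
  open import Axiom.UniquenessOfIdentityProofs using (module Decidable⇒UIP)
  open import Data.Bool using (Bool; true; false; _∧_; _∨_; not)
  import Data.Bool as B
  open import Data.Bool.ListAction using (all; any; and)
  open import Data.Empty using (⊥-elim)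
  open import Data.Fin using (Fin; zero; suc; _≟_; inject≤; punchIn)
  open import Data.Fin.Properties using (+↔⊎; punchInᵢ≢i; suc-injective; inject≤-injective)
  open import Data.Fin.Subset using (Subset; ∣_∣; _∈_)
  import Data.List as List
  open import Data.List.Properties using (map-cong)
  import Data.List.Relation.Unary.All.Properties as All
  import Data.List.Relation.Unary.Any.Properties as Any
  open import Data.Nat using (ℕ; zero; suc; _+_; _*_; _∸_; _≤_; _<_; s≤s; z≤n)
  open import Data.Nat.Properties
    using (+-identityʳ; *-identityˡ; +-suc; +-comm; +-assoc; *-comm; *-assoc; *-zeroʳ; *-identityʳ; *-distribˡ-+;
           ≤-trans; n≤1+n; m≤m+n; +-monoʳ-≤; m+n∸n≡m; m+n∸m≡n; m+[n∸m]≡n; n∸n≡0; +-*-semiring)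
  open import Algebra.Properties.Semiring.Sum +-*-semiring
    using (sum; sum-cong-≗; ∑-distrib-+; ∑-comm; *-distribˡ-sum; *-distribʳ-sum; sum-remove)
  open import Data.Integer as ℤ using (_-_)
  open import Data.Integer.Properties using (pos-+; pos-*)
  open import Data.Integer.Tactic.RingSolver using (solve-∀)
  open import Data.Product using (Σ; ∃; ∃₂; _×_; _,_; proj₁; proj₂)
  open import Data.Sum using (_⊎_; inj₁; inj₂; [_,_]′)
  open import Data.Sum.Function.Propositional using (_⊎-↔_)
  open import Data.Unit using (⊤; tt)
  open import Data.Vec using (Vec; []; _∷_; _++_; _∷ʳ_; lookup; tabulate; take; drop)
  open import Data.Vec.Properties
    using (lookup∘tabulate; tabulate∘lookup; tabulate-cong; lookup-take-inject≤; take++drop≡id;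
           ++-injectiveʳ; []=⇒lookup; lookup⇒[]=)
  open import Function using (_∘_; id; _⇔_; mk⇔; Equivalence)
  open import Function.Bundles using (_↔_; mk↔ₛ′; Inverse; Injection)
  open import Function.Properties.Inverse using (↔-refl; ↔-sym; ↔-trans; ↔⇒↣)
  open import Relation.Binary.PropositionalEquality
  open import Relation.Nullary using (Dec; yes; no; ¬_)
  open import Relation.Nullary.Decidable using (⌊_⌋; isYes≗does; toWitness; dec-true; dec-false)

  ⟦_⟧ : Bool → ℕ
  ⟦ true ⟧ = 1
  ⟦ false ⟧ = 0

  ⟦⟧*-cong : ∀ b {x y} → (b ≡ true → x ≡ y) → ⟦ b ⟧ * x ≡ ⟦ b ⟧ * y
  ⟦⟧*-cong true x≡y = cong (1 *_) (x≡y refl)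
  ⟦⟧*-cong false _ = refl

  δ₀ : ℕ → ℕ
  δ₀ zero = 1
  δ₀ (suc _) = 0

  sum-≡0 : ∀ {k} {f : Fin k → ℕ} → (∀ i → f i ≡ 0) → sum f ≡ 0
  sum-≡0 {zero} h = refl
  sum-≡0 {suc k} h = cong₂ _+_ (h zero) (sum-≡0 (h ∘ suc))

  sum-supported-at : ∀ {k} {f : Fin k → ℕ} i → (∀ j → j ≢ i → f j ≡ 0) → sum f ≡ f i
  sum-supported-at {suc k} {f} i h = begin
    sum f                                 ≡⟨ sum-remove {i = i} f ⟩
    f i + sum (f ∘ punchIn i)             ≡⟨ cong (f i +_) (sum-≡0 λ j → h (punchIn i j) (punchInᵢ≢i i j)) ⟩
    f i + 0                               ≡⟨ +-identityʳ (f i) ⟩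
    f i                                   ∎
    where open ≡-Reasoning

  sum-ones : ∀ k → sum {k} (λ _ → 1) ≡ k
  sum-ones zero = refl
  sum-ones (suc k) = cong suc (sum-ones k)

  ∣∣≡sum : ∀ {m} (p : Subset m) → ∣ p ∣ ≡ sum (λ x → ⟦ lookup p x ⟧)
  ∣∣≡sum [] = refl
  ∣∣≡sum (true ∷ p) = cong suc (∣∣≡sum p)
  ∣∣≡sum (false ∷ p) = ∣∣≡sum p

  Bool-≡-irrelevant : ∀ {a b : Bool} (p q : a ≡ b) → p ≡ q
  Bool-≡-irrelevant = Decidable⇒UIP.≡-irrelevant B._≟_

  Σ-≡true-≡ : ∀ {A : Set} {P : A → Bool} {a b : A} {p : P a ≡ true} {q : P b ≡ true} →
              a ≡ b → _≡_ {A = Σ A λ x → P x ≡ true} (a , p) (b , q)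
  Σ-≡true-≡ {p = p} {q} refl = cong (_ ,_) (Bool-≡-irrelevant p q)

  Fin-cong : ∀ {a b} → a ≡ b → Fin a ↔ Fin b
  Fin-cong refl = ↔-refl

  ≡true↔Fin⟦_⟧ : ∀ b → (b ≡ true) ↔ Fin ⟦ b ⟧
  ≡true↔Fin⟦ true ⟧ = mk↔ₛ′ (λ _ → zero) (λ _ → refl) (λ { zero → refl }) (Bool-≡-irrelevant refl)
  ≡true↔Fin⟦ false ⟧ = mk↔ₛ′ (λ ()) (λ ()) (λ ()) (λ ())

  Σ-Fin-suc↔⊎ : ∀ {k} (P : Fin (suc k) → Set) → Σ (Fin (suc k)) P ↔ (P zero ⊎ Σ (Fin k) (P ∘ suc))
  Σ-Fin-suc↔⊎ P = mk↔ₛ′ to from to∘from from∘to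
    where
    to : Σ _ P → P zero ⊎ Σ _ (P ∘ suc)
    to (zero , p) = inj₁ p
    to (suc i , p) = inj₂ (i , p)
    from : P zero ⊎ Σ _ (P ∘ suc) → Σ _ P
    from (inj₁ p) = zero , p
    from (inj₂ (i , p)) = suc i , p
    to∘from : ∀ y → to (from y) ≡ y
    to∘from (inj₁ p) = refl
    to∘from (inj₂ (i , p)) = refl
    from∘to : ∀ x → from (to x) ≡ x
    from∘to (zero , p) = refl
    from∘to (suc i , p) = refl

  Σ-Fin↔sum : ∀ {k} {P : Fin k → Set} (f : Fin k → ℕ) → (∀ i → P i ↔ Fin (f i)) → Σ (Fin k) P ↔ Fin (sum f)
  Σ-Fin↔sum {zero} f h = mk↔ₛ′ (λ ()) (λ ()) (λ ()) (λ ())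
  Σ-Fin↔sum {suc k} {P} f h =
    ↔-trans (Σ-Fin-suc↔⊎ P) (↔-trans (h zero ⊎-↔ Σ-Fin↔sum (f ∘ suc) (h ∘ suc)) (↔-sym +↔⊎))

  Σ-Vec-∷↔ : ∀ {A : Set} {r} (P : Vec A (suc r) → Set) →
             Σ (Vec A (suc r)) P ↔ Σ A λ y → Σ (Vec A r) λ z → P (y ∷ z)
  Σ-Vec-∷↔ P = mk↔ₛ′ (λ { (y ∷ z , p) → y , z , p }) (λ (y , z , p) → y ∷ z , p)
    (λ _ → refl) (λ { (y ∷ z , p) → refl })

  ∧-true⁻ : ∀ {a b} → a ∧ b ≡ true → a ≡ true × b ≡ true
  ∧-true⁻ {a} {b} h = ∧-conicalˡ a b h , ∧-conicalʳ a b h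

  ∨-true⁻ : ∀ {a b} → a ∨ b ≡ true → a ≡ true ⊎ b ≡ true
  ∨-true⁻ {true} _ = inj₁ refl
  ∨-true⁻ {false} h = inj₂ h

  not-true⁻ : ∀ {a} → not a ≡ true → a ≡ false
  not-true⁻ = not-injective

  true≢false : ∀ {a} → a ≡ true → a ≢ false
  true≢false refl ()

  ⌊⌋-true⁻ : ∀ {A : Set} (d : Dec A) → ⌊ d ⌋ ≡ true → A
  ⌊⌋-true⁻ d h = toWitness {a? = d} (Equivalence.from T-≡ h)

  ⌊⌋-true : ∀ {A : Set} (d : Dec A) → A → ⌊ d ⌋ ≡ true
  ⌊⌋-true d a = trans (isYes≗does d) (dec-true d a)

  ⌊⌋-false : ∀ {A : Set} (d : Dec A) → ¬ A → ⌊ d ⌋ ≡ false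
  ⌊⌋-false d ¬a = trans (isYes≗does d) (dec-false d ¬a)

  all-tabulate⁻ : ∀ {A : Set} {k} (p : A → Bool) (f : Fin k → A) →
                  all p (List.tabulate f) ≡ true → ∀ i → p (f i) ≡ true
  all-tabulate⁻ p f h i = Equivalence.to T-≡ (All.tabulate⁻ (All.all⁺ p _ (Equivalence.from T-≡ h)) i)

  all-tabulate⁺ : ∀ {A : Set} {k} (p : A → Bool) (f : Fin k → A) →
                  (∀ i → p (f i) ≡ true) → all p (List.tabulate f) ≡ true
  all-tabulate⁺ p f h = Equivalence.to T-≡ (All.all⁻ p (All.tabulate⁺ (Equivalence.from T-≡ ∘ h)))

  any-tabulate⁻ : ∀ {A : Set} {k} (p : A → Bool) (f : Fin k → A) →
                  any p (List.tabulate f) ≡ true → ∃ λ i → p (f i) ≡ true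
  any-tabulate⁻ p f h with Any.tabulate⁻ (Any.any⁻ p _ (Equivalence.from T-≡ h))
  ... | i , pfi = i , Equivalence.to T-≡ pfi

  any-tabulate⁺ : ∀ {A : Set} {k} (p : A → Bool) (f : Fin k → A) →
                  ∃ (λ i → p (f i) ≡ true) → any p (List.tabulate f) ≡ true
  any-tabulate⁺ p f (i , pfi) = Equivalence.to T-≡ (Any.any⁺ p (Any.tabulate⁺ i (Equivalence.from T-≡ pfi)))

  lookup-++-inject≤ : ∀ {A : Set} {k t} (v : Vec A k) (z : Vec A t) i .(p : k ≤ k + t) →
                      lookup (v ++ z) (inject≤ i p) ≡ lookup v i
  lookup-++-inject≤ (x ∷ v) z zero p = refl
  lookup-++-inject≤ (x ∷ v) z (suc i) p = lookup-++-inject≤ v z i _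

  drop-++ : ∀ {A : Set} {k t} (v : Vec A k) (z : Vec A t) → drop k (v ++ z) ≡ z
  drop-++ {k = k} v z = ++-injectiveʳ (take k (v ++ z)) v (take++drop≡id k (v ++ z))

  a+b≡c⇒a≡c-b : ∀ {a b c} → a + b ≡ c → ℤ.+ a ≡ ℤ.+ c - ℤ.+ b
  a+b≡c⇒a≡c-b {a} {b} refl = trans (x≡x+y-y (ℤ.+ a) (ℤ.+ b)) (cong (_- ℤ.+ b) (sym (pos-+ a b)))
    where
    x≡x+y-y : ∀ x y → x ≡ x ℤ.+ y - y
    x≡x+y-y = solve-∀

  module Cliques (Γ : Graph) where
    open Graph Γ

    VSet : Set
    VSet = Fin n → Bool

    count : VSet → ℕ
    count U = sum λ x → ⟦ U x ⟧

    _∩nbrs_ : VSet → Fin n → VSet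
    (U ∩nbrs y) x = U x ∧ adj y x

    nonNbrs : Fin n → VSet
    nonNbrs u x = not (adj u x) ∧ not ⌊ x ≟ u ⌋

    cliqueIn : VSet → ∀ {r} → Vec (Fin n) r → Bool
    cliqueIn U [] = true
    cliqueIn U (y ∷ z) = U y ∧ cliqueIn (U ∩nbrs y) z

    #cliques : VSet → ℕ → ℕ
    #cliques U zero = 1
    #cliques U (suc r) = sum λ y → ⟦ U y ⟧ * #cliques (U ∩nbrs y) r

    -- linkSum U G r is the sum of |U ∩ Lk z| over the ordered r-cliques z in G.
    linkSum : VSet → VSet → ℕ → ℕ
    linkSum U G zero = count U
    linkSum U G (suc r) = sum λ y → ⟦ G y ⟧ * linkSum (U ∩nbrs y) (G ∩nbrs y) r

    ∩nbrs-cong : ∀ {U V} → U ≗ V → ∀ y → U ∩nbrs y ≗ V ∩nbrs y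
    ∩nbrs-cong U≗V y x = cong (_∧ adj y x) (U≗V x)

    ∩nbrs-comm : ∀ U x y → (U ∩nbrs x) ∩nbrs y ≗ (U ∩nbrs y) ∩nbrs x
    ∩nbrs-comm U x y w = ∧-swapʳ (U w) (adj x w) (adj y w)

    #cliques-cong : ∀ r {U V} → U ≗ V → #cliques U r ≡ #cliques V r
    #cliques-cong zero U≗V = refl
    #cliques-cong (suc r) U≗V =
      sum-cong-≗ λ y → cong₂ _*_ (cong ⟦_⟧ (U≗V y)) (#cliques-cong r (∩nbrs-cong U≗V y))

    linkSum-cong : ∀ r {U V} G → U ≗ V → linkSum U G r ≡ linkSum V G r
    linkSum-cong zero G U≗V = sum-cong-≗ (cong ⟦_⟧ ∘ U≗V)
    linkSum-cong (suc r) G U≗V = sum-cong-≗ λ y → cong (⟦ G y ⟧ *_) (linkSum-cong r (G ∩nbrs y) (∩nbrs-cong U≗V y))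

    cliques↔ : ∀ r U → Σ (Vec (Fin n) r) (λ z → cliqueIn U z ≡ true) ↔ Fin (#cliques U r)
    cliques↔ zero U = mk↔ₛ′ (λ _ → zero) (λ _ → [] , refl) (λ { zero → refl })
                            (λ { ([] , p) → cong ([] ,_) (Bool-≡-irrelevant refl p) })
    cliques↔ (suc r) U = ↔-trans (Σ-Vec-∷↔ _) (Σ-Fin↔sum _ fibre)
      where
      fibre : ∀ y → Σ (Vec (Fin n) r) (λ z → U y ∧ cliqueIn (U ∩nbrs y) z ≡ true)
                  ↔ Fin (⟦ U y ⟧ * #cliques (U ∩nbrs y) r)
      fibre y with U y
      ... | true = ↔-trans (cliques↔ r (U ∩nbrs y)) (Fin-cong (sym (+-identityʳ _)))
      ... | false = mk↔ₛ′ (λ { (_ , ()) }) (λ ()) (λ ()) (λ { (_ , ()) })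

    throughNbrs : ℕ → VSet → VSet → Fin n → ℕ
    throughNbrs r U G u = sum λ x → ⟦ U x ∧ adj u x ⟧ * #cliques (G ∩nbrs x) r

    module _ {U G : VSet} {u : Fin n} (G≗U∩nonNbrs : ∀ x → G x ≡ U x ∧ nonNbrs u x) where

      G-nonAdjacent : ∀ {x} → G x ≡ true → adj u x ≡ false
      G-nonAdjacent {x} Gx =
        not-true⁻ (proj₁ (∧-true⁻ {not (adj u x)} (proj₂ (∧-true⁻ {U x} (trans (sym (G≗U∩nonNbrs x)) Gx)))))

      ∩nbrs-nonNbrs : ∀ y x → (G ∩nbrs y) x ≡ (U ∩nbrs y) x ∧ nonNbrs u x
      ∩nbrs-nonNbrs y x = trans (cong (_∧ adj y x) (G≗U∩nonNbrs x)) (∧-swapʳ (U x) _ _)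

    ⟦⟧-trichotomy : ∀ a b e → (e ≡ true → b ≡ false) →
                    ⟦ a ⟧ ≡ ⟦ a ∧ (not b ∧ not e) ⟧ * 1 + (⟦ a ∧ e ⟧ + ⟦ a ∧ b ⟧ * 1)
    ⟦⟧-trichotomy false b e _ = refl
    ⟦⟧-trichotomy true false false _ = refl
    ⟦⟧-trichotomy true false true _ = refl
    ⟦⟧-trichotomy true true false _ = refl
    ⟦⟧-trichotomy true true true e⇒¬b with e⇒¬b refl
    ... | ()

    ⟦⟧-exchange : ∀ g a b c X → ⟦ g ⟧ * (⟦ (a ∧ b) ∧ c ⟧ * X) ≡ ⟦ a ∧ c ⟧ * (⟦ g ∧ b ⟧ * X)
    ⟦⟧-exchange false a b c X = sym (*-zeroʳ ⟦ a ∧ c ⟧)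
    ⟦⟧-exchange true false b c X = refl
    ⟦⟧-exchange true true false c X = sym (*-zeroʳ ⟦ c ⟧)
    ⟦⟧-exchange true true true false X = refl
    ⟦⟧-exchange true true true true X = refl

    ⟦⟧-disjoint : ∀ g a c k → (g ≡ true → c ≡ false) → ⟦ g ⟧ * (k * ⟦ a ∧ c ⟧) ≡ 0
    ⟦⟧-disjoint false a c k _ = refl
    ⟦⟧-disjoint true a c k g⇒¬c rewrite g⇒¬c refl | ∧-zeroʳ a = cong (_+ 0) (*-zeroʳ k)

    sum-⟦∧≟⟧ : ∀ (U : VSet) u → sum (λ x → ⟦ U x ∧ ⌊ x ≟ u ⌋ ⟧) ≡ ⟦ U u ⟧
    sum-⟦∧≟⟧ U u = begin
      sum (λ x → ⟦ U x ∧ ⌊ x ≟ u ⌋ ⟧)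
        ≡⟨ sum-supported-at u (λ x x≢u → trans (cong (λ b → ⟦ U x ∧ b ⟧) (⌊⌋-false (x ≟ u) x≢u))
                                                (cong ⟦_⟧ (∧-zeroʳ (U x)))) ⟩
      ⟦ U u ∧ ⌊ u ≟ u ⌋ ⟧
        ≡⟨ trans (cong (λ b → ⟦ U u ∧ b ⟧) (⌊⌋-true (u ≟ u) refl)) (cong ⟦_⟧ (∧-identityʳ (U u))) ⟩
      ⟦ U u ⟧ ∎
      where open ≡-Reasoning

    sum-throughNbrs : ∀ r U G u → sum (λ y → ⟦ G y ⟧ * throughNbrs r (U ∩nbrs y) (G ∩nbrs y) u) ≡ throughNbrs (suc r) U G u
    sum-throughNbrs r U G u = begin
      sum (λ y → ⟦ G y ⟧ * sum (f y))
        ≡⟨ sum-cong-≗ (λ y → *-distribˡ-sum ⟦ G y ⟧ (f y)) ⟩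
      sum (λ y → sum (λ x → ⟦ G y ⟧ * f y x))
        ≡⟨ ∑-comm (λ y x → ⟦ G y ⟧ * f y x) ⟩
      sum (λ x → sum (λ y → ⟦ G y ⟧ * f y x))
        ≡⟨ sum-cong-≗ (λ x → sum-cong-≗ (λ y → trans
             (cong₂ (λ b X → ⟦ G y ⟧ * (⟦ (U x ∧ b) ∧ adj u x ⟧ * X)) (adj-sym y x) (#cliques-cong r (∩nbrs-comm G y x)))
             (⟦⟧-exchange (G y) (U x) (adj x y) (adj u x) _))) ⟩
      sum (λ x → sum (λ y → ⟦ U x ∧ adj u x ⟧ * g x y))
        ≡⟨ sum-cong-≗ (λ x → *-distribˡ-sum ⟦ U x ∧ adj u x ⟧ (g x)) ⟨
      throughNbrs (suc r) U G u ∎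
      where
      open ≡-Reasoning
      f : Fin n → Fin n → ℕ
      f y x = ⟦ (U x ∧ adj y x) ∧ adj u x ⟧ * #cliques ((G ∩nbrs y) ∩nbrs x) r
      g : Fin n → Fin n → ℕ
      g x y = ⟦ G y ∧ adj x y ⟧ * #cliques ((G ∩nbrs x) ∩nbrs y) r

    -- Each vertex of U ∩ Lk(z), for z an ordered r-clique in G, either extends z inside G,
    -- or is u itself (possible only for r = 0), or is adjacent to u.
    linkSum-split : ∀ r U G u → (∀ x → G x ≡ U x ∧ nonNbrs u x) →
                    linkSum U G r ≡ #cliques G (suc r) + (δ₀ r * ⟦ U u ⟧ + throughNbrs r U G u)
    linkSum-split zero U G u G≗ = begin
      sum (λ x → ⟦ U x ⟧)
        ≡⟨ sum-cong-≗ (λ x → trans (⟦⟧-trichotomy (U x) (adj u x) ⌊ x ≟ u ⌋ (u≡⇒nonAdj x))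
                                   (cong (λ b → ⟦ b ⟧ * 1 + _) (sym (G≗ x)))) ⟩
      sum (λ x → ⟦ G x ⟧ * 1 + (⟦ U x ∧ ⌊ x ≟ u ⌋ ⟧ + ⟦ U x ∧ adj u x ⟧ * 1))
        ≡⟨ trans (∑-distrib-+ (λ x → ⟦ G x ⟧ * 1) _) (cong (#cliques G 1 +_) (∑-distrib-+ (λ x → ⟦ U x ∧ ⌊ x ≟ u ⌋ ⟧) _)) ⟩
      #cliques G 1 + (sum (λ x → ⟦ U x ∧ ⌊ x ≟ u ⌋ ⟧) + throughNbrs 0 U G u)
        ≡⟨ cong (λ t → #cliques G 1 + (t + throughNbrs 0 U G u)) (trans (sum-⟦∧≟⟧ U u) (sym (*-identityˡ ⟦ U u ⟧))) ⟩
      #cliques G 1 + (1 * ⟦ U u ⟧ + throughNbrs 0 U G u) ∎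
      where
      open ≡-Reasoning
      u≡⇒nonAdj : ∀ x → ⌊ x ≟ u ⌋ ≡ true → adj u x ≡ false
      u≡⇒nonAdj x x≡u with ⌊⌋-true⁻ (x ≟ u) x≡u
      ... | refl = adj-irrefl x
    linkSum-split (suc r) U G u G≗ = begin
      sum (λ y → ⟦ G y ⟧ * linkSum (U ∩nbrs y) (G ∩nbrs y) r)
        ≡⟨ sum-cong-≗ (λ y → trans (cong (⟦ G y ⟧ *_) (linkSum-split r _ _ u (∩nbrs-nonNbrs {U} {G} {u} G≗ y)))
                                   (distrib₃ ⟦ G y ⟧ _ _ _)) ⟩
      sum (λ y → ⟦ G y ⟧ * #cliques (G ∩nbrs y) (suc r) + (⟦ G y ⟧ * (δ₀ r * ⟦ U u ∧ adj y u ⟧) + T y))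
        ≡⟨ trans (∑-distrib-+ (λ y → ⟦ G y ⟧ * #cliques (G ∩nbrs y) (suc r)) _)
                 (cong (#cliques G (suc (suc r)) +_) (∑-distrib-+ (λ y → ⟦ G y ⟧ * (δ₀ r * ⟦ U u ∧ adj y u ⟧)) T)) ⟩
      #cliques G (suc (suc r)) + (sum (λ y → ⟦ G y ⟧ * (δ₀ r * ⟦ U u ∧ adj y u ⟧)) + sum T)
        ≡⟨ cong (λ t → #cliques G (suc (suc r)) + (t + sum T)) (sum-≡0 λ y →
             ⟦⟧-disjoint (G y) (U u) (adj y u) (δ₀ r) (trans (adj-sym y u) ∘ G-nonAdjacent {U} {G} {u} G≗)) ⟩
      #cliques G (suc (suc r)) + sum T
        ≡⟨ cong (#cliques G (suc (suc r)) +_) (sum-throughNbrs r U G u) ⟩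
      #cliques G (suc (suc r)) + throughNbrs (suc r) U G u ∎
      where
      open ≡-Reasoning
      T : Fin n → ℕ
      T y = ⟦ G y ⟧ * throughNbrs r (U ∩nbrs y) (G ∩nbrs y) u
      distrib₃ : ∀ a b c d → a * (b + (c + d)) ≡ a * b + (a * c + a * d)
      distrib₃ a b c d = trans (*-distribˡ-+ a b _) (cong (a * b +_) (*-distribˡ-+ a c d))

    link : ∀ {j} → Vec (Fin n) j → VSet
    link [] x = true
    link (y ∷ s) x = adj y x ∧ link s x

    vertices : ∀ {j} → Vec (Fin n) j → VSet
    vertices [] x = false
    vertices (y ∷ s) x = ⌊ y ≟ x ⌋ ∨ vertices s x

    IsOrdClique : ∀ {j} → Vec (Fin n) j → Set
    IsOrdClique [] = ⊤
    IsOrdClique (y ∷ s) = link s y ≡ true × IsOrdClique s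

    link⇒adj : ∀ {j} (s : Vec (Fin n) j) {x} → link s x ≡ true → ∀ i → adj (lookup s i) x ≡ true
    link⇒adj (y ∷ s) h zero = proj₁ (∧-true⁻ h)
    link⇒adj (y ∷ s) h (suc i) = link⇒adj s (proj₂ (∧-true⁻ {adj y _} h)) i

    adj⇒link : ∀ {j} (s : Vec (Fin n) j) {x} → (∀ i → adj (lookup s i) x ≡ true) → link s x ≡ true
    adj⇒link [] h = refl
    adj⇒link (y ∷ s) h = cong₂ _∧_ (h zero) (adj⇒link s (h ∘ suc))

    vertices⇒lookup : ∀ {j} (s : Vec (Fin n) j) {x} → vertices s x ≡ true → ∃ λ i → lookup s i ≡ x
    vertices⇒lookup (y ∷ s) {x} h with ∨-true⁻ {⌊ y ≟ x ⌋} h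
    ... | inj₁ y≡x = zero , ⌊⌋-true⁻ (y ≟ x) y≡x
    ... | inj₂ hs with vertices⇒lookup s hs
    ...   | i , sᵢ≡x = suc i , sᵢ≡x

    lookup⇒vertices : ∀ {j} (s : Vec (Fin n) j) {x} i → lookup s i ≡ x → vertices s x ≡ true
    lookup⇒vertices (y ∷ s) zero y≡x = cong (_∨ _) (⌊⌋-true (y ≟ _) y≡x)
    lookup⇒vertices (y ∷ s) {x} (suc i) sᵢ≡x with ⌊ y ≟ x ⌋
    ... | true = refl
    ... | false = lookup⇒vertices s i sᵢ≡x

    link⇒∉vertices : ∀ {j} (s : Vec (Fin n) j) {x} → link s x ≡ true → vertices s x ≡ false
    link⇒∉vertices [] _ = refl
    link⇒∉vertices (y ∷ s) {x} h with ∧-true⁻ {adj y x} h | y ≟ x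
    ... | adjyx , _ | yes refl = ⊥-elim (true≢false adjyx (adj-irrefl y))
    ... | _ , hs | no _ = link⇒∉vertices s hs

    IsOrdClique⇒adj : ∀ {j} (s : Vec (Fin n) j) → IsOrdClique s →
                      ∀ i i′ → i ≢ i′ → adj (lookup s i) (lookup s i′) ≡ true
    IsOrdClique⇒adj (y ∷ s) (ys , ps) zero zero i≢i′ = ⊥-elim (i≢i′ refl)
    IsOrdClique⇒adj (y ∷ s) (ys , ps) zero (suc i′) _ = trans (adj-sym y _) (link⇒adj s ys i′)
    IsOrdClique⇒adj (y ∷ s) (ys , ps) (suc i) zero _ = link⇒adj s ys i
    IsOrdClique⇒adj (y ∷ s) (ys , ps) (suc i) (suc i′) i≢i′ = IsOrdClique⇒adj s ps i i′ (i≢i′ ∘ cong suc)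

    adj⇒IsOrdClique : ∀ {j} (s : Vec (Fin n) j) →
                      (∀ i i′ → i ≢ i′ → adj (lookup s i) (lookup s i′) ≡ true) → IsOrdClique s
    adj⇒IsOrdClique [] h = tt
    adj⇒IsOrdClique (y ∷ s) h =
      adj⇒link s (λ i → h (suc i) zero λ ()) , adj⇒IsOrdClique s (λ i i′ i≢i′ → h (suc i) (suc i′) (i≢i′ ∘ suc-injective))

    link-++ : ∀ {a b} (v : Vec (Fin n) a) (z : Vec (Fin n) b) x → link (v ++ z) x ≡ link v x ∧ link z x
    link-++ [] z x = refl
    link-++ (y ∷ v) z x = trans (cong (adj y x ∧_) (link-++ v z x)) (sym (∧-assoc (adj y x) _ _))

    vertices-++ : ∀ {a b} (v : Vec (Fin n) a) (z : Vec (Fin n) b) x →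
                  vertices (v ++ z) x ≡ vertices v x ∨ vertices z x
    vertices-++ [] z x = refl
    vertices-++ (y ∷ v) z x = trans (cong (⌊ y ≟ x ⌋ ∨_) (vertices-++ v z x)) (sym (∨-assoc ⌊ y ≟ x ⌋ _ _))

    IsOrdClique-++⁻ : ∀ {a b} (v : Vec (Fin n) a) (z : Vec (Fin n) b) → IsOrdClique (v ++ z) →
                      IsOrdClique v × IsOrdClique z × (∀ i → link v (lookup z i) ≡ true)
    IsOrdClique-++⁻ [] z p = tt , p , λ _ → refl
    IsOrdClique-++⁻ (y ∷ v) z (h , p) with IsOrdClique-++⁻ v z p | ∧-true⁻ (trans (sym (link-++ v z y)) h)
    ... | pv , pz , z⊆link | hv , hz =
      (hv , pv) , pz , λ i → cong₂ _∧_ (trans (adj-sym y _) (link⇒adj z hz i)) (z⊆link i)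

    IsOrdClique-++⁺ : ∀ {a b} (v : Vec (Fin n) a) (z : Vec (Fin n) b) → IsOrdClique v → IsOrdClique z →
                      (∀ i → link v (lookup z i) ≡ true) → IsOrdClique (v ++ z)
    IsOrdClique-++⁺ [] z _ pz _ = pz
    IsOrdClique-++⁺ (y ∷ v) z (hv , pv) pz z⊆link =
      trans (link-++ v z y) (cong₂ _∧_ hv (adj⇒link z λ i → trans (adj-sym _ y) (proj₁ (∧-true⁻ (z⊆link i))))) ,
      IsOrdClique-++⁺ v z pv pz (λ i → proj₂ (∧-true⁻ {adj y _} (z⊆link i)))

    link-∷ʳ : ∀ {k} (v : Vec (Fin n) k) u x → link (v ∷ʳ u) x ≡ link v x ∧ adj u x
    link-∷ʳ [] u x = ∧-identityʳ (adj u x)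
    link-∷ʳ (y ∷ v) u x = trans (cong (adj y x ∧_) (link-∷ʳ v u x)) (sym (∧-assoc (adj y x) _ _))

    IsOrdClique-∷ʳ⁻ : ∀ {k} (v : Vec (Fin n) k) u → IsOrdClique (v ∷ʳ u) → IsOrdClique (u ∷ v)
    IsOrdClique-∷ʳ⁻ [] u _ = refl , tt
    IsOrdClique-∷ʳ⁻ (y ∷ v) u (h , p) with IsOrdClique-∷ʳ⁻ v u p | ∧-true⁻ (trans (sym (link-∷ʳ v u y)) h)
    ... | hu , pv | yv , uy = cong₂ _∧_ (trans (adj-sym y u) uy) hu , yv , pv

    cliqueIn⇔ : ∀ U {r} (z : Vec (Fin n) r) →
                cliqueIn U z ≡ true ⇔ ((∀ i → U (lookup z i) ≡ true) × IsOrdClique z)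
    cliqueIn⇔ U z = mk⇔ (to U z) (λ (z⊆U , pz) → from U z z⊆U pz)
      where
      to : ∀ U {r} (z : Vec (Fin n) r) → cliqueIn U z ≡ true → (∀ i → U (lookup z i) ≡ true) × IsOrdClique z
      to U [] h = (λ ()) , tt
      to U (y ∷ z) h with ∧-true⁻ h
      ... | Uy , hz with to (U ∩nbrs y) z hz
      ...   | z⊆U∩y , pz = z⊆U , adj⇒link z (λ i → trans (adj-sym _ y) (proj₂ (∧-true⁻ (z⊆U∩y i)))) , pz
        where
        z⊆U : ∀ i → U (lookup (y ∷ z) i) ≡ true
        z⊆U zero = Uy
        z⊆U (suc i) = proj₁ (∧-true⁻ (z⊆U∩y i))
      from : ∀ U {r} (z : Vec (Fin n) r) → (∀ i → U (lookup z i) ≡ true) → IsOrdClique z → cliqueIn U z ≡ true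
      from U [] _ _ = refl
      from U (y ∷ z) z⊆U (hz , pz) =
        cong₂ _∧_ (z⊆U zero) (from (U ∩nbrs y) z (λ i → cong₂ _∧_ (z⊆U (suc i)) (trans (adj-sym y _) (link⇒adj z hz i))) pz)

    lookup-toSet : ∀ {j} (s : Vec (Fin n) j) x → lookup (toSet Γ s) x ≡ vertices s x
    lookup-toSet s x = trans (lookup∘tabulate _ x) (⇔→≡ {z = true} (mk⇔
      (λ h → let i , sᵢ≡x = any-tabulate⁻ sᵢ≟x id h in lookup⇒vertices s i (⌊⌋-true⁻ (lookup s i ≟ x) sᵢ≡x))
      (λ h → let i , sᵢ≡x = vertices⇒lookup s h in any-tabulate⁺ sᵢ≟x id (i , ⌊⌋-true (lookup s i ≟ x) sᵢ≡x))))
      where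
      sᵢ≟x : Fin _ → Bool
      sᵢ≟x i = ⌊ lookup s i ≟ x ⌋

    ∈toSet⇒lookup : ∀ {j} (s : Vec (Fin n) j) {x} → x ∈ toSet Γ s → ∃ λ i → lookup s i ≡ x
    ∈toSet⇒lookup s {x} x∈s = vertices⇒lookup s (trans (sym (lookup-toSet s x)) ([]=⇒lookup x∈s))

    lookup-Lk-toSet : ∀ {j} (s : Vec (Fin n) j) x → lookup (Lk Γ (toSet Γ s)) x ≡ link s x
    lookup-Lk-toSet s x = trans (lookup∘tabulate _ x) (⇔→≡ {z = true} (mk⇔ to from))
      where
      σ = toSet Γ s
      to : not (lookup σ x) ∧ allF Γ n (λ z → not (lookup σ z) ∨ adj z x) ≡ true → link s x ≡ true
      to h = adj⇒link s λ i →
        [ (λ sᵢ∉σ → ⊥-elim (true≢false (trans (lookup-toSet s _) (lookup⇒vertices s i refl)) (not-true⁻ sᵢ∉σ))) , id ]′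
          (∨-true⁻ (all-tabulate⁻ _ id (proj₂ (∧-true⁻ {not (lookup σ x)} h)) (lookup s i)))
      from : link s x ≡ true → not (lookup σ x) ∧ allF Γ n (λ z → not (lookup σ z) ∨ adj z x) ≡ true
      from h = cong₂ _∧_ (cong not (trans (lookup-toSet s x) (link⇒∉vertices s h))) (all-tabulate⁺ _ id σ⊆nbrs)
        where
        σ⊆nbrs : ∀ z → not (lookup σ z) ∨ adj z x ≡ true
        σ⊆nbrs z with lookup σ z in z∈σ
        ... | false = refl
        ... | true with vertices⇒lookup s (trans (sym (lookup-toSet s z)) z∈σ)
        ...   | i , sᵢ≡z = subst (λ w → adj w x ≡ true) sᵢ≡z (link⇒adj s h i)

    count-vertices : ∀ {j} (s : Vec (Fin n) j) → IsOrdClique s → count (vertices s) ≡ j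
    count-vertices [] _ = sum-≡0 {n} {λ _ → 0} λ _ → refl
    count-vertices (y ∷ s) (ys , ps) = begin
      sum (λ x → ⟦ ⌊ y ≟ x ⌋ ∨ vertices s x ⟧)        ≡⟨ sum-cong-≗ disjoint ⟩
      sum (λ x → ⟦ ⌊ y ≟ x ⌋ ⟧ + ⟦ vertices s x ⟧)     ≡⟨ ∑-distrib-+ (λ x → ⟦ ⌊ y ≟ x ⌋ ⟧) _ ⟩
      sum (λ x → ⟦ ⌊ y ≟ x ⌋ ⟧) + count (vertices s) ≡⟨ cong₂ _+_ singleton (count-vertices s ps) ⟩
      suc _                                            ∎
      where
      open ≡-Reasoning
      disjoint : ∀ x → ⟦ ⌊ y ≟ x ⌋ ∨ vertices s x ⟧ ≡ ⟦ ⌊ y ≟ x ⌋ ⟧ + ⟦ vertices s x ⟧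
      disjoint x with y ≟ x
      ... | yes refl = cong (λ b → 1 + ⟦ b ⟧) (sym (link⇒∉vertices s ys))
      ... | no _ = refl
      singleton : sum (λ x → ⟦ ⌊ y ≟ x ⌋ ⟧) ≡ 1
      singleton = trans (sum-supported-at y (λ x x≢y → cong ⟦_⟧ (⌊⌋-false (y ≟ x) (x≢y ∘ sym))))
                        (cong ⟦_⟧ (⌊⌋-true (y ≟ y) refl))

    ∣toSet∣ : ∀ {j} (s : Vec (Fin n) j) → IsOrdClique s → ∣ toSet Γ s ∣ ≡ j
    ∣toSet∣ s p = trans (∣∣≡sum (toSet Γ s)) (trans (sum-cong-≗ (cong ⟦_⟧ ∘ lookup-toSet s)) (count-vertices s p))

    toSet-IsClique : ∀ {j} (s : Vec (Fin n) j) → IsOrdClique s → IsClique Γ (toSet Γ s)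
    toSet-IsClique s p x y x∈s y∈s x≢y with ∈toSet⇒lookup s x∈s | ∈toSet⇒lookup s y∈s
    ... | i , refl | i′ , refl = IsOrdClique⇒adj s p i i′ (x≢y ∘ cong (lookup s))

    OrdClique⇔ : ∀ {m} (w : Vec (Fin n) m) → OrdClique Γ w ≡ true ⇔ IsOrdClique w
    OrdClique⇔ w = mk⇔
      (λ h → adj⇒IsOrdClique w λ i i′ i≢i′ →
        [ ⊥-elim ∘ i≢i′ ∘ ⌊⌋-true⁻ (i ≟ i′) , id ]′ (∨-true⁻ (all-tabulate⁻ _ id (all-tabulate⁻ _ id h i) i′)))
      (λ p → all-tabulate⁺ _ id λ i → all-tabulate⁺ _ id λ i′ → equal-or-adjacent p i i′)
      where
      equal-or-adjacent : IsOrdClique w → ∀ i i′ → ⌊ i ≟ i′ ⌋ ∨ adj (lookup w i) (lookup w i′) ≡ true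
      equal-or-adjacent p i i′ with i ≟ i′
      ... | yes _ = refl
      ... | no i≢i′ = IsOrdClique⇒adj w p i i′ i≢i′

    inLkRel : ∀ {a b} → Vec (Fin n) a → Vec (Fin n) b → Fin n → Bool
    inLkRel w w′ u = not (vertices w u) ∧ allF Γ n (λ x → not (vertices w x) ∨ ⌊ adj u x B.≟ vertices w′ x ⌋)

    lookup-LkRel-toSet : ∀ {a b} (w : Vec (Fin n) a) (w′ : Vec (Fin n) b) u →
                         lookup (LkRel Γ (toSet Γ w) (toSet Γ w′)) u ≡ inLkRel w w′ u
    lookup-LkRel-toSet w w′ u = trans (lookup∘tabulate _ u)
      (cong₂ _∧_ (cong not (lookup-toSet w u))
                 (cong and (map-cong (λ x → cong₂ _∨_ (cong not (lookup-toSet w x))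
                                                      (cong (λ b → ⌊ adj u x B.≟ b ⌋) (lookup-toSet w′ x)))
                                     (List.allFin n))))

    extensions : ∀ {k} → Vec (Fin n) k → Fin n → VSet
    extensions v u x = link v x ∧ nonNbrs u x

    inLkRel-++⇔ : ∀ {k t} (v : Vec (Fin n) k) u (z : Vec (Fin n) t) → link v u ≡ true →
                  (∀ i → link v (lookup z i) ≡ true) →
                  inLkRel (v ++ z) v u ≡ true ⇔ (∀ i → nonNbrs u (lookup z i) ≡ true)
    inLkRel-++⇔ v u z u∈link z⊆link = mk⇔ to from
      where
      z⊆v++z : ∀ i → vertices (v ++ z) (lookup z i) ≡ true
      z⊆v++z i = trans (vertices-++ v z _) (trans (cong (vertices v (lookup z i) ∨_) (lookup⇒vertices z i refl)) (∨-zeroʳ _))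
      to : inLkRel (v ++ z) v u ≡ true → ∀ i → nonNbrs u (lookup z i) ≡ true
      to h i = cong₂ _∧_ (cong not u≁zᵢ) (cong not (⌊⌋-false (lookup z i ≟ u) zᵢ≢u))
        where
        u∉ : vertices (v ++ z) u ≡ false
        u∉ = not-true⁻ (proj₁ (∧-true⁻ h))
        zᵢ≢u : lookup z i ≢ u
        zᵢ≢u zᵢ≡u = true≢false (subst (λ x → vertices (v ++ z) x ≡ true) zᵢ≡u (z⊆v++z i)) u∉
        u≁zᵢ : adj u (lookup z i) ≡ false
        u≁zᵢ with ∨-true⁻ (all-tabulate⁻ _ id (proj₂ (∧-true⁻ {not (vertices (v ++ z) u)} h)) (lookup z i))
        ... | inj₁ zᵢ∉ = ⊥-elim (true≢false (z⊆v++z i) (not-true⁻ zᵢ∉))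
        ... | inj₂ agree = trans (⌊⌋-true⁻ (adj u _ B.≟ vertices v _) agree) (link⇒∉vertices v (z⊆link i))
      from : (∀ i → nonNbrs u (lookup z i) ≡ true) → inLkRel (v ++ z) v u ≡ true
      from z⊆nonNbrs = cong₂ _∧_ (cong not u∉) (all-tabulate⁺ _ id agree)
        where
        zᵢ≢u : ∀ i → lookup z i ≢ u
        zᵢ≢u i = not-¬ (not-true⁻ (proj₂ (∧-true⁻ {not (adj u _)} (z⊆nonNbrs i)))) ∘ ⌊⌋-true (lookup z i ≟ u)
        u∉ : vertices (v ++ z) u ≡ false
        u∉ = trans (vertices-++ v z u) (cong₂ _∨_ (link⇒∉vertices v u∈link)
                     (¬-not λ u∈z → let i , zᵢ≡u = vertices⇒lookup z u∈z in zᵢ≢u i zᵢ≡u))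
        agree : ∀ x → not (vertices (v ++ z) x) ∨ ⌊ adj u x B.≟ vertices v x ⌋ ≡ true
        agree x with vertices (v ++ z) x in x∈v++z
        ... | false = refl
        ... | true with ∨-true⁻ (trans (sym (vertices-++ v z x)) x∈v++z)
        ...   | inj₁ x∈v = let i , vᵢ≡x = vertices⇒lookup v x∈v in ⌊⌋-true (adj u x B.≟ vertices v x)
                  (trans (trans (adj-sym u x) (subst (λ y → adj y u ≡ true) vᵢ≡x (link⇒adj v u∈link i))) (sym x∈v))
        ...   | inj₂ x∈z = let i , zᵢ≡x = vertices⇒lookup z x∈z in ⌊⌋-true (adj u x B.≟ vertices v x)
                  (subst (λ y → adj u y ≡ vertices v y) zᵢ≡x
                    (trans (not-true⁻ (proj₁ (∧-true⁻ (z⊆nonNbrs i)))) (sym (link⇒∉vertices v (z⊆link i)))))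

    ordClique-in-clique : ∀ {σ j} → IsClique Γ σ → j ≤ ∣ σ ∣ → Σ (Vec (Fin n) j) IsOrdClique
    ordClique-in-clique {σ} {j} σ-clique j≤∣σ∣ = s , adj⇒IsOrdClique s adjacent
      where
      elements : Fin ∣ σ ∣ ↔ Σ (Fin n) (λ x → lookup σ x ≡ true)
      elements = ↔-sym (↔-trans (Σ-Fin↔sum _ (λ x → ≡true↔Fin⟦ lookup σ x ⟧)) (Fin-cong (sym (∣∣≡sum σ))))
      element : Fin j → Σ (Fin n) (λ x → lookup σ x ≡ true)
      element i = Inverse.to elements (inject≤ i j≤∣σ∣)
      s : Vec (Fin n) j
      s = tabulate (proj₁ ∘ element)
      adjacent : ∀ i i′ → i ≢ i′ → adj (lookup s i) (lookup s i′) ≡ true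
      adjacent i i′ i≢i′ rewrite lookup∘tabulate (proj₁ ∘ element) i | lookup∘tabulate (proj₁ ∘ element) i′ =
        σ-clique _ _ (lookup⇒[]= _ σ (proj₂ (element i))) (lookup⇒[]= _ σ (proj₂ (element i′)))
          (i≢i′ ∘ inject≤-injective _ _ i i′ ∘ Injection.injective (↔⇒↣ elements) ∘ Σ-≡true-≡)

    prefix-++ : ∀ {k t} (p : k ≤ k + t) (v : Vec (Fin n) k) (z : Vec (Fin n) t) → prefix Γ p (v ++ z) ≡ v
    prefix-++ p v z = trans (tabulate-cong (λ i → lookup-++-inject≤ v z i p)) (tabulate∘lookup v)

    Counted-++⇔ : ∀ {k t} (p : k ≤ k + t) (v : Vec (Fin n) k) u (z : Vec (Fin n) t) → IsOrdClique (u ∷ v) →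
                  Counted Γ p v u (v ++ z) ≡ true ⇔ cliqueIn (extensions v u) z ≡ true
    Counted-++⇔ {k} p v u z (u∈link , pv) = mk⇔ to from
      where
      matches-v : Fin k → Bool
      matches-v i = ⌊ lookup (v ++ z) (inject≤ i p) ≟ lookup v i ⌋
      LkRel≡inLkRel : lookup (LkRel Γ (toSet Γ (v ++ z)) (toSet Γ (prefix Γ p (v ++ z)))) u ≡ inLkRel (v ++ z) v u
      LkRel≡inLkRel = trans (cong (λ w′ → lookup (LkRel Γ (toSet Γ (v ++ z)) (toSet Γ w′)) u) (prefix-++ p v z))
                            (lookup-LkRel-toSet (v ++ z) v u)
      to : Counted Γ p v u (v ++ z) ≡ true → cliqueIn (extensions v u) z ≡ true
      to h with ∧-true⁻ h
      ... | oc , rest with IsOrdClique-++⁻ v z (Equivalence.to (OrdClique⇔ (v ++ z)) oc)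
      ...   | _ , pz , z⊆link =
        Equivalence.from (cliqueIn⇔ (extensions v u) z) ((λ i → cong₂ _∧_ (z⊆link i) (z⊆nonNbrs i)) , pz)
        where
        z⊆nonNbrs : ∀ i → nonNbrs u (lookup z i) ≡ true
        z⊆nonNbrs = Equivalence.to (inLkRel-++⇔ v u z u∈link z⊆link)
                                   (trans (sym LkRel≡inLkRel) (proj₂ (∧-true⁻ {allF Γ k matches-v} rest)))
      from : cliqueIn (extensions v u) z ≡ true → Counted Γ p v u (v ++ z) ≡ true
      from h with Equivalence.to (cliqueIn⇔ (extensions v u) z) h
      ... | z⊆ext , pz = cong₂ _∧_
        (Equivalence.from (OrdClique⇔ (v ++ z)) (IsOrdClique-++⁺ v z pv pz z⊆link))
        (cong₂ _∧_ (all-tabulate⁺ matches-v id λ i → ⌊⌋-true (_ ≟ _) (lookup-++-inject≤ v z i p))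
                   (trans LkRel≡inLkRel (Equivalence.from (inLkRel-++⇔ v u z u∈link z⊆link) z⊆nonNbrs)))
        where
        z⊆link : ∀ i → link v (lookup z i) ≡ true
        z⊆link i = proj₁ (∧-true⁻ (z⊆ext i))
        z⊆nonNbrs : ∀ i → nonNbrs u (lookup z i) ≡ true
        z⊆nonNbrs i = proj₂ (∧-true⁻ {link v (lookup z i)} (z⊆ext i))

    Counted↔cliques : ∀ {k t} (p : k ≤ k + t) (v : Vec (Fin n) k) u → IsOrdClique (u ∷ v) →
                      Σ (Vec (Fin n) (k + t)) (λ w → Counted Γ p v u w ≡ true)
                        ↔ Σ (Vec (Fin n) t) (λ z → cliqueIn (extensions v u) z ≡ true)
    Counted↔cliques {k} p v u c = mk↔ₛ′
      (λ (w , h) → drop k w , Equivalence.to (Counted-++⇔ p v u (drop k w) c)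
                                            (subst (λ w′ → Counted Γ p v u w′ ≡ true) (split-at-v h) h))
      (λ (z , h) → v ++ z , Equivalence.from (Counted-++⇔ p v u z c) h)
      (λ (z , _) → Σ-≡true-≡ (drop-++ v z))
      (λ (w , h) → Σ-≡true-≡ (sym (split-at-v h)))
      where
      split-at-v : ∀ {w} → Counted Γ p v u w ≡ true → w ≡ v ++ drop k w
      split-at-v {w} h = trans (sym (take++drop≡id k w)) (cong (_++ drop k w) take≡v)
        where
        take≡v : take k w ≡ v
        take≡v = begin
          take k w                                  ≡⟨ tabulate∘lookup (take k w) ⟨
          tabulate (lookup (take k w))              ≡⟨ tabulate-cong (λ i → trans (lookup-take-inject≤ w i)
                                                         (⌊⌋-true⁻ (_ ≟ _) (all-tabulate⁻ _ id prefix-matches i))) ⟩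
          tabulate (lookup v)                       ≡⟨ tabulate∘lookup v ⟩
          v                                         ∎
          where
          open ≡-Reasoning
          prefix-matches = proj₁ (∧-true⁻ (proj₂ (∧-true⁻ {OrdClique Γ w} h)))

  module LinkRegularCounts (Γ : Graph) (d : ℕ) (ℓ : ℕ → ℕ) (ℓ₀≡n : ℓ 0 ≡ Graph.n Γ)
    (∣Lk∣≡ℓ : ∀ k σ → 1 ≤ k → k ≤ d → IsClique Γ σ → ∣ σ ∣ ≡ k → ∣ Lk Γ σ ∣ ≡ ℓ k) where
    open Graph Γ
    open Cliques Γ

    count-link : ∀ {j} (s : Vec (Fin n) j) → IsOrdClique s → j ≤ d → count (link s) ≡ ℓ j
    count-link [] _ _ = trans (sum-ones n) (sym ℓ₀≡n)
    count-link {suc j} s p j≤d = begin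
      count (link s)                              ≡⟨ sum-cong-≗ (cong ⟦_⟧ ∘ lookup-Lk-toSet s) ⟨
      sum (λ x → ⟦ lookup (Lk Γ (toSet Γ s)) x ⟧) ≡⟨ ∣∣≡sum (Lk Γ (toSet Γ s)) ⟨
      ∣ Lk Γ (toSet Γ s) ∣                        ≡⟨ ∣Lk∣≡ℓ (suc j) (toSet Γ s) (s≤s z≤n) j≤d
                                                                 (toSet-IsClique s p) (∣toSet∣ s p) ⟩
      ℓ (suc j)                                   ∎
      where open ≡-Reasoning

    -- Every ordered r-clique z in G extends s to an ordered (j + r)-clique, whose link has ℓ (j + r) vertices.
    linkSum-link : ∀ r {j} (s : Vec (Fin n) j) {G} → IsOrdClique s → (∀ x → G x ≡ true → link s x ≡ true) →
                   j + r ≤ d → linkSum (link s) G r ≡ ℓ (j + r) * #cliques G r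
    linkSum-link zero {j} s p _ j≤d =
      trans (count-link s p (subst (_≤ d) (+-identityʳ j) j≤d)) (trans (cong ℓ (sym (+-identityʳ j))) (sym (*-identityʳ _)))
    linkSum-link (suc r) {j} s {G} p G⊆link j+r≤d = begin
      sum (λ y → ⟦ G y ⟧ * linkSum (link s ∩nbrs y) (G ∩nbrs y) r)
        ≡⟨ sum-cong-≗ (λ y → ⟦⟧*-cong (G y) (extend y)) ⟩
      sum (λ y → ⟦ G y ⟧ * (ℓ (j + suc r) * #cliques (G ∩nbrs y) r))
        ≡⟨ sum-cong-≗ (λ y → x*[y*z]≡y*[x*z] ⟦ G y ⟧ (ℓ (j + suc r)) _) ⟩
      sum (λ y → ℓ (j + suc r) * (⟦ G y ⟧ * #cliques (G ∩nbrs y) r))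
        ≡⟨ *-distribˡ-sum (ℓ (j + suc r)) (λ y → ⟦ G y ⟧ * #cliques (G ∩nbrs y) r) ⟨
      ℓ (j + suc r) * #cliques G (suc r) ∎
      where
      open ≡-Reasoning
      x*[y*z]≡y*[x*z] : ∀ x y z → x * (y * z) ≡ y * (x * z)
      x*[y*z]≡y*[x*z] x y z = trans (sym (*-assoc x y z)) (trans (cong (_* z) (*-comm x y)) (*-assoc y x z))
      extend : ∀ y → G y ≡ true → linkSum (link s ∩nbrs y) (G ∩nbrs y) r ≡ ℓ (j + suc r) * #cliques (G ∩nbrs y) r
      extend y Gy = begin
        linkSum (link s ∩nbrs y) (G ∩nbrs y) r
          ≡⟨ linkSum-cong r _ (λ x → ∧-comm (link s x) (adj y x)) ⟩
        linkSum (link (y ∷ s)) (G ∩nbrs y) r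
          ≡⟨ linkSum-link r (y ∷ s) (G⊆link y Gy , p)
               (λ x Gx∧yx → let Gx , yx = ∧-true⁻ Gx∧yx in cong₂ _∧_ yx (G⊆link x Gx))
               (subst (_≤ d) (+-suc j r) j+r≤d) ⟩
        ℓ (suc j + r) * #cliques (G ∩nbrs y) r
          ≡⟨ cong (λ i → ℓ i * #cliques (G ∩nbrs y) r) (+-suc j r) ⟨
        ℓ (j + suc r) * #cliques (G ∩nbrs y) r ∎

    -- Φ j r is the count N_{j+r, j}; its defining recurrence holds up to the truncation of ∸.
    Φ : ℕ → ℕ → ℕ
    Φ j zero = 1
    Φ j (suc r) = ℓ (j + r) * Φ j r ∸ (δ₀ r + ℓ (suc j) * Φ (suc j) r)

    #cliques-recurrence : ∀ r {j} (v : Vec (Fin n) j) u → IsOrdClique (u ∷ v) → j + suc r ≤ d →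
      (∀ {j′} (v′ : Vec (Fin n) j′) → IsOrdClique (u ∷ v′) → j′ + r ≤ d → #cliques (extensions v′ u) r ≡ Φ j′ r) →
      #cliques (extensions v u) (suc r) + (δ₀ r + ℓ (suc j) * Φ (suc j) r) ≡ ℓ (j + r) * Φ j r
    #cliques-recurrence r {j} v u (u∈link , pv) j+r<d IH = begin
      #cliques G (suc r) + (δ₀ r + ℓ (suc j) * Φ (suc j) r)
        ≡⟨ cong₂ (λ a b → #cliques G (suc r) + (a + b))
                 (trans (sym (*-identityʳ (δ₀ r))) (cong (λ b → δ₀ r * ⟦ b ⟧) (sym u∈link))) (sym throughNbrs≡) ⟩
      #cliques G (suc r) + (δ₀ r * ⟦ link v u ⟧ + throughNbrs r (link v) G u)
        ≡⟨ linkSum-split r (link v) G u (λ _ → refl) ⟨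
      linkSum (link v) G r
        ≡⟨ linkSum-link r v pv (λ x Gx → proj₁ (∧-true⁻ Gx)) j+r≤d ⟩
      ℓ (j + r) * #cliques G r
        ≡⟨ cong (ℓ (j + r) *_) (IH v (u∈link , pv) j+r≤d) ⟩
      ℓ (j + r) * Φ j r ∎
      where
      open ≡-Reasoning
      G = extensions v u
      j+r≤d : j + r ≤ d
      j+r≤d = ≤-trans (+-monoʳ-≤ j (n≤1+n r)) j+r<d
      throughNbrs≡ : throughNbrs r (link v) G u ≡ ℓ (suc j) * Φ (suc j) r
      throughNbrs≡ = begin
        sum (λ x → ⟦ link v x ∧ adj u x ⟧ * #cliques (G ∩nbrs x) r)
          ≡⟨ sum-cong-≗ (λ x → ⟦⟧*-cong (link v x ∧ adj u x) (from-x x)) ⟩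
        sum (λ x → ⟦ link v x ∧ adj u x ⟧ * Φ (suc j) r)
          ≡⟨ *-distribʳ-sum (Φ (suc j) r) (λ x → ⟦ link v x ∧ adj u x ⟧) ⟨
        sum (λ x → ⟦ link v x ∧ adj u x ⟧) * Φ (suc j) r
          ≡⟨ cong (_* Φ (suc j) r) (sum-cong-≗ (λ x → cong ⟦_⟧ (∧-comm (link v x) (adj u x)))) ⟩
        count (link (u ∷ v)) * Φ (suc j) r
          ≡⟨ cong (_* Φ (suc j) r) (count-link (u ∷ v) (u∈link , pv)
                                        (≤-trans (m≤m+n (suc j) r) (subst (_≤ d) (+-suc j r) j+r<d))) ⟩
        ℓ (suc j) * Φ (suc j) r ∎
        where
        from-x : ∀ x → link v x ∧ adj u x ≡ true → #cliques (G ∩nbrs x) r ≡ Φ (suc j) r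
        from-x x vx∧ux = let vx , ux = ∧-true⁻ vx∧ux in trans
          (#cliques-cong r (λ y → trans (∧-swapʳ (link v y) (nonNbrs u y) (adj x y))
                                         (cong (_∧ nonNbrs u y) (∧-comm (link v y) (adj x y)))))
          (IH (x ∷ v) (cong₂ _∧_ (trans (adj-sym x u) ux) u∈link , vx , pv) (subst (_≤ d) (+-suc j r) j+r<d))

    #cliques-extensions : ∀ r {j} (v : Vec (Fin n) j) u → IsOrdClique (u ∷ v) → j + r ≤ d →
                          #cliques (extensions v u) r ≡ Φ j r
    #cliques-extensions zero _ _ _ _ = refl
    #cliques-extensions (suc r) {j} v u c j+r<d = begin
      #cliques (extensions v u) (suc r)
        ≡⟨ m+n∸n≡m _ (δ₀ r + ℓ (suc j) * Φ (suc j) r) ⟨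
      #cliques (extensions v u) (suc r) + (δ₀ r + ℓ (suc j) * Φ (suc j) r) ∸ (δ₀ r + ℓ (suc j) * Φ (suc j) r)
        ≡⟨ cong (_∸ (δ₀ r + ℓ (suc j) * Φ (suc j) r))
                (#cliques-recurrence r v u c j+r<d (λ v′ c′ → #cliques-extensions r v′ u c′)) ⟩
      Φ j (suc r) ∎
      where open ≡-Reasoning

    Φ-recurrence : ∀ j r {v : Vec (Fin n) j} {u} → IsOrdClique (u ∷ v) → j + suc r ≤ d →
                   Φ j (suc r) + (δ₀ r + ℓ (suc j) * Φ (suc j) r) ≡ ℓ (j + r) * Φ j r
    Φ-recurrence j r {v} {u} c j+r<d =
      trans (cong (_+ (δ₀ r + ℓ (suc j) * Φ (suc j) r)) (sym (#cliques-extensions (suc r) v u c j+r<d)))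
            (#cliques-recurrence r v u c j+r<d (λ v′ c′ → #cliques-extensions r v′ u c′))

    Φ-subdiagonal : ∀ j {v : Vec (Fin n) j} {u} → IsOrdClique (u ∷ v) → j + 1 ≤ d →
                    ℤ.+ Φ j 1 ≡ ℤ.+ ℓ j - ℤ.+ ℓ (suc j) - ℤ.+ 1
    Φ-subdiagonal j c j+1≤d = begin
      ℤ.+ Φ j 1
        ≡⟨ a+b≡c⇒a≡c-b (Φ-recurrence j 0 c j+1≤d) ⟩
      ℤ.+ (ℓ (j + 0) * 1) - ℤ.+ (1 + ℓ (suc j) * 1)
        ≡⟨ cong₂ (λ a b → ℤ.+ a - ℤ.+ (1 + b)) (trans (*-identityʳ _) (cong ℓ (+-identityʳ j))) (*-identityʳ _) ⟩
      ℤ.+ ℓ j - (ℤ.+ 1 ℤ.+ ℤ.+ ℓ (suc j))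
        ≡⟨ x-[1+y]≡x-y-1 (ℤ.+ ℓ j) (ℤ.+ ℓ (suc j)) ⟩
      ℤ.+ ℓ j - ℤ.+ ℓ (suc j) - ℤ.+ 1 ∎
      where
      open ≡-Reasoning
      x-[1+y]≡x-y-1 : ∀ x y → x - (ℤ.+ 1 ℤ.+ y) ≡ x - y - ℤ.+ 1
      x-[1+y]≡x-y-1 = solve-∀

    Φ-step : ∀ j t {v : Vec (Fin n) j} {u} → IsOrdClique (u ∷ v) → j + suc (suc t) ≤ d →
             ℤ.+ Φ j (suc (suc t)) ≡ ℤ.+ ℓ (j + suc t) ℤ.* ℤ.+ Φ j (suc t) - ℤ.+ ℓ (suc j) ℤ.* ℤ.+ Φ (suc j) (suc t)
    Φ-step j t c j+t+2≤d = trans (a+b≡c⇒a≡c-b (Φ-recurrence j (suc t) c j+t+2≤d))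
                                 (cong₂ _-_ (pos-* (ℓ (j + suc t)) _) (pos-* (ℓ (suc j)) _))

    N : ℕ → ℕ → ℕ
    N m k = Φ k (m ∸ k)

    N-+ : ∀ k t → N (k + t) k ≡ Φ k t
    N-+ k t = cong (Φ k) (m+n∸m≡n k t)

    N-diagonal : ∀ m → N m m ≡ 1
    N-diagonal m = cong (Φ m) (n∸n≡0 m)

    Counted↔N : ∀ m k → m ≤ d → (k≤m : k ≤ m) (v : Vec (Fin n) k) (u : Fin n) → OrdClique Γ (v ∷ʳ u) ≡ true →
                Σ (Vec (Fin n) m) (λ w → Counted Γ k≤m v u w ≡ true) ↔ Fin (N m k)
    Counted↔N m k m≤d k≤m v u v∷ʳu-clique = go (m ∸ k) (m+[n∸m]≡n k≤m) k≤m m≤d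
      where
      c : IsOrdClique (u ∷ v)
      c = IsOrdClique-∷ʳ⁻ v u (Equivalence.to (OrdClique⇔ (v ∷ʳ u)) v∷ʳu-clique)
      go : ∀ {m} t → k + t ≡ m → (k≤m : k ≤ m) → m ≤ d →
           Σ (Vec (Fin n) m) (λ w → Counted Γ k≤m v u w ≡ true) ↔ Fin (Φ k t)
      go t refl k≤m k+t≤d = ↔-trans (Counted↔cliques k≤m v u c)
        (↔-trans (cliques↔ t (extensions v u)) (Fin-cong (#cliques-extensions t v u c k+t≤d)))

    module _ {σ} (σ-clique : IsClique Γ σ) (∣σ∣≡d : ∣ σ ∣ ≡ d) where

      ordClique-of-size : ∀ j → suc j ≤ d → ∃₂ λ (v : Vec (Fin n) j) u → IsOrdClique (u ∷ v)
      ordClique-of-size j j<d with ordClique-in-clique σ-clique (subst (suc j ≤_) (sym ∣σ∣≡d) j<d)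
      ... | u ∷ v , c = v , u , c

      N-subdiagonal : ∀ m → 1 ≤ m → m ≤ d → ℤ.+ N m (m ∸ 1) ≡ ℤ.+ ℓ (m ∸ 1) - ℤ.+ ℓ m - ℤ.+ 1
      N-subdiagonal (suc j) _ j<d with ordClique-of-size j j<d
      ... | _ , _ , c = trans (cong (ℤ.+_ ∘ Φ j) (m+n∸n≡m 1 j)) (Φ-subdiagonal j c (subst (_≤ d) (+-comm 1 j) j<d))

      N-recurrence : ∀ m k → m ≤ d → k + 1 < m →
                     ℤ.+ N m k ≡ ℤ.+ ℓ (m ∸ 1) ℤ.* ℤ.+ N (m ∸ 1) k - ℤ.+ ℓ (k + 1) ℤ.* ℤ.+ N m (k + 1)
      N-recurrence m k m≤d k+1<m = go (m ∸ suc (suc k)) m≡ m≤d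
        where
        m≡ : k + suc (suc (m ∸ suc (suc k))) ≡ m
        m≡ = trans (trans (+-suc k _) (cong suc (+-suc k _)))
                   (m+[n∸m]≡n (subst (λ i → suc i ≤ m) (+-comm k 1) k+1<m))
        go : ∀ {m} t → k + suc (suc t) ≡ m → m ≤ d →
             ℤ.+ N m k ≡ ℤ.+ ℓ (m ∸ 1) ℤ.* ℤ.+ N (m ∸ 1) k - ℤ.+ ℓ (k + 1) ℤ.* ℤ.+ N m (k + 1)
        go t refl k+t+2≤d with ordClique-of-size k (≤-trans (m≤m+n (suc k) (suc t)) (subst (_≤ d) (+-suc k (suc t)) k+t+2≤d))
        ... | _ , _ , c = begin
          ℤ.+ N (k + suc (suc t)) k
            ≡⟨ cong ℤ.+_ (N-+ k (suc (suc t))) ⟩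
          ℤ.+ Φ k (suc (suc t))
            ≡⟨ Φ-step k t c k+t+2≤d ⟩
          ℤ.+ ℓ (k + suc t) ℤ.* ℤ.+ Φ k (suc t) - ℤ.+ ℓ (suc k) ℤ.* ℤ.+ Φ (suc k) (suc t)
            ≡⟨ cong₂ (λ x y → ℤ.+ ℓ (k + suc t) ℤ.* ℤ.+ x - ℤ.+ ℓ (suc k) ℤ.* ℤ.+ y) (N-+ k (suc t)) N-k+1 ⟨
          ℤ.+ ℓ (k + suc t) ℤ.* ℤ.+ N (k + suc t) k - ℤ.+ ℓ (suc k) ℤ.* ℤ.+ N (k + suc (suc t)) (k + 1)
            ≡⟨ cong₂ (λ i j → ℤ.+ ℓ i ℤ.* ℤ.+ N i k - ℤ.+ ℓ j ℤ.* ℤ.+ N (k + suc (suc t)) (k + 1))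
                     (cong (_∸ 1) (+-suc k (suc t))) (+-comm k 1) ⟨
          ℤ.+ ℓ (k + suc (suc t) ∸ 1) ℤ.* ℤ.+ N (k + suc (suc t) ∸ 1) k - ℤ.+ ℓ (k + 1) ℤ.* ℤ.+ N (k + suc (suc t)) (k + 1) ∎
          where
          open ≡-Reasoning
          N-k+1 : N (k + suc (suc t)) (k + 1) ≡ Φ (suc k) (suc t)
          N-k+1 = trans (cong (λ i → N i (k + 1)) (sym (+-assoc k 1 (suc t))))
                        (trans (N-+ (k + 1) (suc t)) (cong (λ i → Φ i (suc t)) (+-comm k 1)))


open import Defs
open import Data.Nat using (ℕ; _≤_; _<_; _+_; _∸_)
open import Data.Integer using (ℤ; +_; _-_; _*_)
open import Data.Bool using (true)
open import Data.Fin using (Fin)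
open import Data.Fin.Subset using (∣_∣)
open import Data.Vec using (Vec; _∷ʳ_)
open import Data.Product using (Σ; _×_; _,_)
open import Function.Bundles using (_↔_)
open import Relation.Binary.PropositionalEquality using (_≡_)

-- LinkRegular is implied by the hypothesis on ℓ, and of the maximality of d only the
-- existence of a d-clique is used (it provides the cliques on which the recurrences are read off).
proposition6p8 : (G : Graph) (d : ℕ) (ℓ : ℕ → ℕ)
  → LinkRegular G
  → MaxCliqueSize G d
  → ℓ 0 ≡ Graph.n G
  → (∀ k σ → 1 ≤ k → k ≤ d → IsClique G σ → ∣ σ ∣ ≡ k → ∣ Lk G σ ∣ ≡ ℓ k)
  → Σ (ℕ → ℕ → ℕ) λ N →
      (∀ m k → 1 ≤ m → m ≤ d → (k≤m : k ≤ m)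
         → (v : Vec (Fin (Graph.n G)) k) (u : Fin (Graph.n G))
         → OrdClique G (v ∷ʳ u) ≡ true
         → Σ (Vec (Fin (Graph.n G)) m) (λ w → Counted G k≤m v u w ≡ true) ↔ Fin (N m k))
      × (∀ m → 1 ≤ m → m ≤ d → N m m ≡ 1)
      × (∀ m → 1 ≤ m → m ≤ d → + N m (m ∸ 1) ≡ + ℓ (m ∸ 1) - + ℓ m - + 1)
      × (∀ m k → 1 ≤ m → m ≤ d → k + 1 < m
         → + N m k ≡ + ℓ (m ∸ 1) * + N (m ∸ 1) k - + ℓ (k + 1) * + N m (k + 1))
proposition6p8 G d ℓ _ ((σ , σ-clique , ∣σ∣≡d) , _) ℓ₀≡n ∣Lk∣≡ℓ =
  N , (λ m k _ → Counted↔N m k) , (λ m _ _ → N-diagonal m) , N-subdiagonal σ-clique ∣σ∣≡d ,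
  λ m k _ → N-recurrence σ-clique ∣σ∣≡d m k
  where open CliqueCounting.LinkRegularCounts G d ℓ ℓ₀≡n ∣Lk∣≡ℓ
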